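{- For $n\ge1$, let $f_n(x)=\sum_A x^{|A|_h}$ over all primitive 2-directed animals $A$ with exactly $2n$ vertical bonds, and let $\breve f_n(s;x)=\sum_A x^{|A|_h}s^{w(A)}$ over uncapped primitive 2-directed animals with exactly $2n$ vertical bonds, where $w(A)$ is the horizontal distance between the two vertical bonds in the topmost row. Then $$f_n(x)=\frac{1}{1-x}\big(\breve f_n(1;x)-x\,\breve f_n(x;x)\big).$$
   Context: A bond-animal on the square lattice is a connected union of bonds (edges), up to translation; it is directed if some root vertex reaches every bond by a path in the animal of north and east steps only. $|A|_h$ is the number of horizontal bonds. A row is a horizontal strip between lattice lines $y=j$ and $y=j+1$. A 2-directed animal is a directed bond-animal with exactly $2$ vertical bonds in each of its rows. A primitive 2-directed animal is a 2-directed animal in which every vertex of degree $1$ lies (horizontally) between vertical bonds. An uncapped primitive 2-directed animal is a primitive 2-directed animal having no horizontal bonds attached to the tops of the vertical bonds in its topmost row. -}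

module Defs where

open import Data.Nat using (ℕ; zero; suc; _+_; _∸_; _≤_; _<_; _≡ᵇ_)
open import Data.Bool using (Bool; true; false; _∧_; _∨_; if_then_else_)
open import Data.Product using (Σ; ∃; ∃-syntax; _×_; _,_)
open import Data.Sum using (_⊎_)
open import Data.List using (List; []; _∷_; length)
open import Data.List.Membership.Propositional using (_∈_)
open import Data.List.Relation.Unary.All using (All)
open import Data.List.Relation.Unary.Linked using (Linked)
open import Data.List.Relation.Unary.Unique.Propositional using (Unique)
open import Data.Integer as ℤ using (ℤ)
open import Relation.Binary.PropositionalEquality using (_≡_; _≢_)
open import Relation.Nullary using (¬_)

Vertex : Set
Vertex = ℕ × ℕ

data Dir : Set where
  hor ver : Dir

-- ⟨ x , y , hor ⟩ is the bond (x,y)–(x+1,y);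
-- ⟨ x , y , ver ⟩ is the bond (x,y)–(x,y+1), lying in row y.
record Bond : Set where
  constructor ⟨_,_,_⟩
  field
    bx  : ℕ
    by  : ℕ
    dir : Dir
open Bond public

src : Bond → Vertex
src b = bx b , by b

tgt : Bond → Vertex
tgt ⟨ x , y , hor ⟩ = suc x , y
tgt ⟨ x , y , ver ⟩ = x , suc y

data _<ᴮ_ : Bond → Bond → Set where
  row< : ∀ {x y d x' y' d'} → y < y' → ⟨ x , y , d ⟩ <ᴮ ⟨ x' , y' , d' ⟩
  col< : ∀ {x y d x' d'} → x < x' → ⟨ x , y , d ⟩ <ᴮ ⟨ x' , y , d' ⟩
  dir< : ∀ {x y} → ⟨ x , y , hor ⟩ <ᴮ ⟨ x , y , ver ⟩

-- A finite set of bonds is represented canonically by a strictly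
-- increasing list of bonds.
BondSet : Set
BondSet = List Bond

Canonical : BondSet → Set
Canonical S = Linked _<ᴮ_ S

_==ⱽ_ : Vertex → Vertex → Bool
(x , y) ==ⱽ (x' , y') = (x ≡ᵇ x') ∧ (y ≡ᵇ y')

incident? : Vertex → Bond → Bool
incident? v b = (src b ==ⱽ v) ∨ (tgt b ==ⱽ v)

deg : BondSet → Vertex → ℕ
deg [] v = 0
deg (b ∷ S) v = if incident? v b then suc (deg S v) else deg S v

isHor : Bond → Bool
isHor ⟨ _ , _ , hor ⟩ = true
isHor ⟨ _ , _ , ver ⟩ = false

isVerIn : ℕ → Bond → Bool
isVerIn j ⟨ _ , y , hor ⟩ = false
isVerIn j ⟨ _ , y , ver ⟩ = y ≡ᵇ j

numH : BondSet → ℕ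
numH [] = 0
numH (b ∷ S) = if isHor b then suc (numH S) else numH S

numV : BondSet → ℕ
numV [] = 0
numV (b ∷ S) = if isHor b then numV S else suc (numV S)

numVIn : ℕ → BondSet → ℕ
numVIn j [] = 0
numVIn j (b ∷ S) = if isVerIn j b then suc (numVIn j S) else numVIn j S

-- Translation classes are represented by the unique
-- translate whose root vertex is the origin (0,0) (the root of a directed
-- animal has minimal x and minimal y, so all coordinates are then in ℕ).

data Reach (S : BondSet) : Vertex → Set where
  origin : Reach S (0 , 0)
  east   : ∀ {x y} → Reach S (x , y) → ⟨ x , y , hor ⟩ ∈ S → Reach S (suc x , y)
  north  : ∀ {x y} → Reach S (x , y) → ⟨ x , y , ver ⟩ ∈ S → Reach S (x , suc y)

Directed : BondSet → Set
Directed S = ∀ b → b ∈ S → Reach S (src b)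

DirectedAnimal : BondSet → Set
DirectedAnimal S = Canonical S × Directed S

TwoDirected : BondSet → Set
TwoDirected S = DirectedAnimal S × (∀ j → numVIn j S ≡ 0 ⊎ numVIn j S ≡ 2)

LiesBetween : BondSet → Vertex → Set
LiesBetween S (x , y) =
  ∃[ j ] ((j ≡ y ⊎ suc j ≡ y) ×
    ∃[ x₁ ] ∃[ x₂ ] (⟨ x₁ , j , ver ⟩ ∈ S × ⟨ x₂ , j , ver ⟩ ∈ S × x₁ ≤ x × x ≤ x₂))

Primitive2D : BondSet → Set
Primitive2D S = TwoDirected S × (∀ v → deg S v ≡ 1 → LiesBetween S v)

TopRow : BondSet → ℕ → Set
TopRow S t = (∃[ x ] ⟨ x , t , ver ⟩ ∈ S) × (∀ x j → ⟨ x , j , ver ⟩ ∈ S → j ≤ t)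

Incident : Vertex → Bond → Set
Incident v b = src b ≡ v ⊎ tgt b ≡ v

Uncapped : BondSet → Set
Uncapped S = ∀ t → TopRow S t → ∀ x → ⟨ x , t , ver ⟩ ∈ S →
  ∀ b → b ∈ S → dir b ≡ hor → ¬ Incident (x , suc t) b

UncappedPrimitive2D : BondSet → Set
UncappedPrimitive2D S = Primitive2D S × Uncapped S

Width : BondSet → ℕ → Set
Width S w = ∃[ t ] (TopRow S t × ∃[ x₁ ] ∃[ x₂ ]
  (⟨ x₁ , t , ver ⟩ ∈ S × ⟨ x₂ , t , ver ⟩ ∈ S × x₁ < x₂ × x₁ + w ≡ x₂))

IsCount : (BondSet → Set) → ℕ → Set
IsCount P m = Σ (List BondSet) λ L →
  Unique L × All P L × (∀ S → P S → S ∈ L) × length L ≡ m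

-- Formal power series in x over ℤ (coefficient sequences)

PS : Set
PS = ℕ → ℤ

sumTo : ℕ → (ℕ → ℤ) → ℤ
sumTo zero f = f 0
sumTo (suc k) f = sumTo k f ℤ.+ f (suc k)

_⊖_ : PS → PS → PS
(f ⊖ g) k = f k ℤ.- g k

_⊛_ : PS → PS → PS
(f ⊛ g) k = sumTo k (λ i → f i ℤ.* g (k ∸ i))

X : PS
X zero = ℤ.0ℤ
X (suc zero) = ℤ.1ℤ
X (suc (suc _)) = ℤ.0ℤ

-- 1/(1-x) = Σ_i x^i
geom : PS
geom _ = ℤ.1ℤ

module Submission where

-- Cutting a primitive 2-directed animal S just above the top row t of its
-- vertical bonds leaves an uncapped primitive 2-directed animal U.  What is
-- cut off is a single run of i horizontal bonds in row t + 1, starting at the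
-- top of the left vertical bond x₁ of row t (directedness) and ending no
-- further right than the right one x₂ (primitivity: the right end of a run
-- beyond x₂ would be a vertex of degree 1 outside every pair of vertical
-- bonds), so 0 ≤ i ≤ w(U) = x₂ − x₁.  Conversely any such U and i glue back
-- to a primitive animal.  Hence
--   a_k = Σ_{i ≤ k} #{U : |U|_h = k − i, w(U) ≥ i}
--       = Σ_{i ≤ k} (b_{k−i} − Σ_{w < i} c_{k−i,w}),
-- which is the coefficient form of f_n = (f̆_n(1;x) − x f̆_n(x;x)) / (1 − x).

open import Defs
open import Data.Nat
  using (ℕ; zero; suc; _+_; _*_; _∸_; _⊔_; _≤_; _<_; _≤?_; _<?_; _≟_; _≡ᵇ_; z≤n; s≤s; s≤s⁻¹)
open import Data.Nat.Properties
open import Data.Nat.Tactic.RingSolver using () renaming (solve-∀ to ℕ-solve)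
open import Data.Integer as ℤ using (0ℤ; 1ℤ)
import Data.Integer.Properties as ℤₚ
open import Data.Integer.Tactic.RingSolver using () renaming (solve-∀ to ℤ-solve)
open import Data.Bool using (true; false; T; if_then_else_)
open import Data.Bool.Properties using (T-≡; T-∧; ∨-zeroʳ)
open import Data.Product using (∃; ∃-syntax; _×_; _,_; proj₁; proj₂)
open import Data.Sum using (_⊎_; inj₁; inj₂)
open import Data.Empty using (⊥; ⊥-elim)
open import Data.List using (List; []; _∷_; length; _++_; filter; map)
open import Data.List.Properties using (length-map; length-++; filter-++; filter-all; filter-none; ++-identityʳ)
open import Data.List.Membership.Propositional using (_∈_)
open import Data.List.Membership.Propositional.Properties
  using (∈-map⁺; ∈-map⁻; ∈-filter⁺; ∈-filter⁻; ∈-++⁺ˡ; ∈-++⁺ʳ; ∈-++⁻)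
open import Data.List.Membership.Propositional.Properties.WithK using (unique∧set⇒bag)
open import Data.List.Relation.Binary.BagAndSetEquality using (∼bag⇒↭)
open import Data.List.Relation.Binary.Permutation.Propositional.Properties using (↭-length)
open import Data.List.Relation.Unary.Any as Any using (here; there)
open import Data.List.Relation.Unary.All as All using (All; []; _∷_)
import Data.List.Relation.Unary.All.Properties as Allₚ
open import Data.List.Relation.Unary.AllPairs as AllPairs using ([]; _∷_)
open import Data.List.Relation.Unary.Linked as Linked using ([]; [-]; _∷_)
import Data.List.Relation.Unary.Linked.Properties as Linkedₚ
open import Data.List.Relation.Unary.Unique.Propositional using (Unique)
import Data.List.Relation.Unary.Unique.Propositional.Properties as Uniqueₚ
open import Function.Bundles using (mk⇔; Equivalence)
open import Relation.Binary.Definitions using (tri<; tri≈; tri>)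
open import Relation.Binary.PropositionalEquality
open import Relation.Nullary using (¬_; Dec; yes; no)

≡true⇒T : ∀ {b} → b ≡ true → T b
≡true⇒T = Equivalence.from T-≡

T⇒≡true : ∀ {b} → T b → b ≡ true
T⇒≡true = Equivalence.to T-≡

unique-set⇒length≡ : {A : Set} {xs ys : List A} → Unique xs → Unique ys →
  (∀ z → z ∈ xs → z ∈ ys) → (∀ z → z ∈ ys → z ∈ xs) → length xs ≡ length ys
unique-set⇒length≡ ux uy f g = ↭-length (∼bag⇒↭ (unique∧set⇒bag ux uy (mk⇔ (f _) (g _))))

IsCount⇒length≡ : {P : BondSet → Set} {m : ℕ} → IsCount P m → (L : List BondSet) → Unique L →
  (∀ S → S ∈ L → P S) → (∀ S → P S → S ∈ L) → length L ≡ m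
IsCount⇒length≡ (L' , u' , all' , cover' , len') L u sound complete =
  trans (unique-set⇒length≡ u u' (λ S S∈ → cover' S (sound S S∈)) (λ S S∈ → complete S (All.lookup all' S∈)))
        len'

map⁺-injectiveOn : {A B : Set} (f : A → B) {xs : List A} →
  (∀ x y → x ∈ xs → y ∈ xs → f x ≡ f y → x ≡ y) → Unique xs → Unique (map f xs)
map⁺-injectiveOn f {[]} inj [] = []
map⁺-injectiveOn f {x ∷ xs} inj (x∉ ∷ u) =
  Allₚ.map⁺ (All.tabulate λ {y} y∈ fx≡fy → All.lookup x∉ y∈ (inj x y (here refl) (there y∈) fx≡fy))
  ∷ map⁺-injectiveOn f (λ a b a∈ b∈ → inj a b (there a∈) (there b∈)) u

<ᴮ-trans : ∀ {a b c} → a <ᴮ b → b <ᴮ c → a <ᴮ c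
<ᴮ-trans (row< p) (row< q) = row< (<-trans p q)
<ᴮ-trans (row< p) (col< q) = row< p
<ᴮ-trans (row< p) dir<     = row< p
<ᴮ-trans (col< p) (row< q) = row< q
<ᴮ-trans (col< p) (col< q) = col< (<-trans p q)
<ᴮ-trans (col< p) dir<     = col< p
<ᴮ-trans dir<     (row< q) = row< q
<ᴮ-trans dir<     (col< q) = col< q

<ᴮ-irrefl : ∀ {a} → ¬ (a <ᴮ a)
<ᴮ-irrefl (row< p) = <-irrefl refl p
<ᴮ-irrefl (col< p) = <-irrefl refl p

<ᴮ⇒≢ : ∀ {a b} → a <ᴮ b → a ≢ b
<ᴮ⇒≢ a<a refl = <ᴮ-irrefl a<a

canonical⇒unique : ∀ {S} → Canonical S → Unique S
canonical⇒unique c = AllPairs.map <ᴮ⇒≢ (Linkedₚ.Linked⇒AllPairs <ᴮ-trans c)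

head-below-tail : ∀ {x xs} → Canonical (x ∷ xs) → All (x <ᴮ_) xs
head-below-tail [-]      = []
head-below-tail (r ∷ rs) = Linkedₚ.Linked⇒All <ᴮ-trans r rs

canonical-≡ : ∀ {xs ys} → Canonical xs → Canonical ys →
  (∀ z → z ∈ xs → z ∈ ys) → (∀ z → z ∈ ys → z ∈ xs) → xs ≡ ys
canonical-≡ {[]} {[]} _ _ f g = refl
canonical-≡ {[]} {y ∷ ys} _ _ f g with g y (here refl)
... | ()
canonical-≡ {x ∷ xs} {[]} _ _ f g with f x (here refl)
... | ()
canonical-≡ {x ∷ xs} {y ∷ ys} cx cy f g = heads (f x (here refl)) (g y (here refl))
  where
  x<xs = head-below-tail cx
  y<ys = head-below-tail cy
  tails : x ≡ y → x ∷ xs ≡ y ∷ ys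
  tails refl = cong (x ∷_) (canonical-≡ (Linked.tail cx) (Linked.tail cy)
    (λ z z∈ → Any.tail (λ z≡x → <ᴮ⇒≢ (All.lookup x<xs z∈) (sym z≡x)) (f z (there z∈)))
    (λ z z∈ → Any.tail (λ z≡x → <ᴮ⇒≢ (All.lookup y<ys z∈) (sym z≡x)) (g z (there z∈))))
  heads : x ∈ (y ∷ ys) → y ∈ (x ∷ xs) → x ∷ xs ≡ y ∷ ys
  heads (here x≡y) _          = tails x≡y
  heads (there _) (here y≡x)  = tails (sym y≡x)
  heads (there x∈) (there y∈) = ⊥-elim (<ᴮ-irrefl (<ᴮ-trans (All.lookup x<xs y∈) (All.lookup y<ys x∈)))

canonical-++ : ∀ {xs ys} → Canonical xs → Canonical ys →
  (∀ a b → a ∈ xs → b ∈ ys → a <ᴮ b) → Canonical (xs ++ ys)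
canonical-++ {[]}         _        cy _ = cy
canonical-++ {x ∷ []} {[]}     _  _  _ = [-]
canonical-++ {x ∷ []} {y ∷ ys} _  cy r = r x y (here refl) (here refl) ∷ cy
canonical-++ {x ∷ x' ∷ xs} (r ∷ rs) cy f = r ∷ canonical-++ rs cy (λ a b a∈ b∈ → f a b (there a∈) b∈)

_≟ᴰ_ : (d e : Dir) → Dec (d ≡ e)
hor ≟ᴰ hor = yes refl
hor ≟ᴰ ver = no (λ ())
ver ≟ᴰ hor = no (λ ())
ver ≟ᴰ ver = yes refl

_≟ᴮ_ : (a b : Bond) → Dec (a ≡ b)
⟨ x , y , d ⟩ ≟ᴮ ⟨ x' , y' , d' ⟩ with x ≟ x' | y ≟ y' | d ≟ᴰ d'
... | yes refl | yes refl | yes refl = yes refl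
... | no x≢x'  | _        | _        = no (λ { refl → x≢x' refl })
... | yes _    | no y≢y'  | _        = no (λ { refl → y≢y' refl })
... | yes _    | yes _    | no d≢d'  = no (λ { refl → d≢d' refl })

open import Data.List.Membership.DecPropositional _≟ᴮ_ using (_∈?_)

==ⱽ⇒≡ : ∀ u v → T (u ==ⱽ v) → u ≡ v
==ⱽ⇒≡ (x , y) (x' , y') t =
  let (tx , ty) = Equivalence.to T-∧ t in cong₂ _,_ (≡ᵇ⇒≡ x x' tx) (≡ᵇ⇒≡ y y' ty)

==ⱽ-refl : ∀ u → u ==ⱽ u ≡ true
==ⱽ-refl (x , y) = T⇒≡true (Equivalence.from T-∧ (≡⇒≡ᵇ x x refl , ≡⇒≡ᵇ y y refl))

incident?⇒Incident : ∀ v b → incident? v b ≡ true → Incident v b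
incident?⇒Incident v b e with src b ==ⱽ v in e₁
... | true  = inj₁ (==ⱽ⇒≡ _ _ (≡true⇒T e₁))
... | false = inj₂ (==ⱽ⇒≡ _ _ (≡true⇒T e))

Incident⇒incident? : ∀ v b → Incident v b → incident? v b ≡ true
Incident⇒incident? v b (inj₁ refl) rewrite ==ⱽ-refl (src b) = refl
Incident⇒incident? v b (inj₂ refl) rewrite ==ⱽ-refl (tgt b) = ∨-zeroʳ _

deg≥1⇒incident : ∀ S v → 1 ≤ deg S v → ∃[ b ] (b ∈ S × Incident v b)
deg≥1⇒incident (b ∷ S) v p with incident? v b in e
... | true  = b , here refl , incident?⇒Incident v b e
... | false = let (c , c∈ , v~c) = deg≥1⇒incident S v p in c , there c∈ , v~c

deg≡0 : ∀ S v → (∀ b → b ∈ S → ¬ Incident v b) → deg S v ≡ 0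
deg≡0 []      v f = refl
deg≡0 (b ∷ S) v f with incident? v b in e
... | true  = ⊥-elim (f b (here refl) (incident?⇒Incident v b e))
... | false = deg≡0 S v (λ c c∈ → f c (there c∈))

deg≡1 : ∀ S v b → Unique S → b ∈ S → Incident v b →
  (∀ c → c ∈ S → Incident v c → c ≡ b) → deg S v ≡ 1
deg≡1 (h ∷ S) v b (h∉ ∷ _) (here refl) v~b only rewrite Incident⇒incident? v h v~b =
  cong suc (deg≡0 S v (λ c c∈ v~c → All.lookup h∉ c∈ (sym (only c (there c∈) v~c))))
deg≡1 (h ∷ S) v b (h∉ ∷ u) (there b∈) v~b only with incident? v h in e
... | true  = ⊥-elim (All.lookup h∉ b∈ (only h (here refl) (incident?⇒Incident v h e)))
... | false = deg≡1 S v b u b∈ v~b (λ c c∈ v~c → only c (there c∈) v~c)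

deg-++ : ∀ S T v → deg (S ++ T) v ≡ deg S v + deg T v
deg-++ []      T v = refl
deg-++ (b ∷ S) T v with incident? v b
... | true  = cong suc (deg-++ S T v)
... | false = deg-++ S T v

numH-++ : ∀ S T → numH (S ++ T) ≡ numH S + numH T
numH-++ []                    T = refl
numH-++ (⟨ _ , _ , hor ⟩ ∷ S) T = cong suc (numH-++ S T)
numH-++ (⟨ _ , _ , ver ⟩ ∷ S) T = numH-++ S T

numV-++ : ∀ S T → numV (S ++ T) ≡ numV S + numV T
numV-++ []                    T = refl
numV-++ (⟨ _ , _ , hor ⟩ ∷ S) T = numV-++ S T
numV-++ (⟨ _ , _ , ver ⟩ ∷ S) T = cong suc (numV-++ S T)

numVIn-++ : ∀ j S T → numVIn j (S ++ T) ≡ numVIn j S + numVIn j T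
numVIn-++ j []      T = refl
numVIn-++ j (b ∷ S) T with isVerIn j b
... | true  = cong suc (numVIn-++ j S T)
... | false = numVIn-++ j S T

numV≥1⇒vertical : ∀ S → 1 ≤ numV S → ∃[ x ] ∃[ j ] (⟨ x , j , ver ⟩ ∈ S)
numV≥1⇒vertical (⟨ _ , _ , hor ⟩ ∷ S) p = let (x , j , x,j∈) = numV≥1⇒vertical S p in x , j , there x,j∈
numV≥1⇒vertical (⟨ x , j , ver ⟩ ∷ S) p = x , j , here refl

-- Caps: runs of horizontal bonds

cap : ℕ → ℕ → ℕ → BondSet
cap x y zero    = []
cap x y (suc i) = ⟨ x , y , hor ⟩ ∷ cap (suc x) y i

numH-cap : ∀ x y i → numH (cap x y i) ≡ i
numH-cap x y zero    = refl
numH-cap x y (suc i) = cong suc (numH-cap (suc x) y i)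

numV-cap : ∀ x y i → numV (cap x y i) ≡ 0
numV-cap x y zero    = refl
numV-cap x y (suc i) = numV-cap (suc x) y i

numVIn-cap : ∀ j x y i → numVIn j (cap x y i) ≡ 0
numVIn-cap j x y zero    = refl
numVIn-cap j x y (suc i) = numVIn-cap j (suc x) y i

∈-cap⁻ : ∀ x y i b → b ∈ cap x y i → ∃[ d ] (d < i × b ≡ ⟨ x + d , y , hor ⟩)
∈-cap⁻ x y (suc i) b (here refl) = 0 , s≤s z≤n , cong (λ z → ⟨ z , y , hor ⟩) (sym (+-identityʳ x))
∈-cap⁻ x y (suc i) b (there b∈) with ∈-cap⁻ (suc x) y i b b∈
... | d , d<i , refl = suc d , s≤s d<i , cong (λ z → ⟨ z , y , hor ⟩) (sym (+-suc x d))

∈-cap⁺ : ∀ x y i d → d < i → ⟨ x + d , y , hor ⟩ ∈ cap x y i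
∈-cap⁺ x y (suc i) zero    _         rewrite +-identityʳ x = here refl
∈-cap⁺ x y (suc i) (suc d) (s≤s d<i) rewrite +-suc x d     = there (∈-cap⁺ (suc x) y i d d<i)

cap-canonical : ∀ x y i → Canonical (cap x y i)
cap-canonical x y zero          = []
cap-canonical x y (suc zero)    = [-]
cap-canonical x y (suc (suc i)) = col< ≤-refl ∷ cap-canonical (suc x) y (suc i)

cap-incident : ∀ {x y i} v b → b ∈ cap x y i → Incident v b →
  ∃[ X ] (v ≡ (X , y) × x ≤ X × X ≤ x + i)
cap-incident {x} {y} {i} v b b∈ v~b with ∈-cap⁻ x y i b b∈
... | d , d<i , refl with v~b
...   | inj₁ refl = x + d , refl , m≤m+n x d , +-monoʳ-≤ x (<⇒≤ d<i)
...   | inj₂ refl = suc (x + d) , refl , ≤-trans (m≤m+n x d) (n≤1+n _) ,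
                    subst (_≤ x + i) (+-suc x d) (+-monoʳ-≤ x d<i)

deg-++-cap : ∀ U x y i v →
  deg (U ++ cap x y i) v ≡ deg U v ⊎ ∃[ X ] (v ≡ (X , y) × x ≤ X × X ≤ x + i)
deg-++-cap U x y i v with deg (cap x y i) v in e
... | zero  = inj₁ (trans (deg-++ U (cap x y i) v) (trans (cong (deg U v +_) e) (+-identityʳ _)))
... | suc _ with deg≥1⇒incident (cap x y i) v (subst (1 ≤_) (sym e) (s≤s z≤n))
...   | b , b∈ , v~b = inj₂ (cap-incident v b b∈ v~b)

topRow : BondSet → ℕ
topRow []                    = 0
topRow (⟨ _ , _ , hor ⟩ ∷ S) = topRow S
topRow (⟨ _ , y , ver ⟩ ∷ S) = y ⊔ topRow S

≤-topRow : ∀ S x j → ⟨ x , j , ver ⟩ ∈ S → j ≤ topRow S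
≤-topRow (⟨ _ , _ , ver ⟩ ∷ S) x j (here refl) = m≤m⊔n j (topRow S)
≤-topRow (⟨ _ , _ , hor ⟩ ∷ S) x j (there p)   = ≤-topRow S x j p
≤-topRow (⟨ _ , y , ver ⟩ ∷ S) x j (there p)   = ≤-trans (≤-topRow S x j p) (m≤n⊔m y (topRow S))

topRow-least : ∀ S t → (∀ x j → ⟨ x , j , ver ⟩ ∈ S → j ≤ t) → topRow S ≤ t
topRow-least []                    t f = z≤n
topRow-least (⟨ _ , _ , hor ⟩ ∷ S) t f = topRow-least S t (λ x j p → f x j (there p))
topRow-least (⟨ x , y , ver ⟩ ∷ S) t f =
  ⊔-lub (f x y (here refl)) (topRow-least S t (λ x j p → f x j (there p)))

topRow≡0⊎attained : ∀ S → topRow S ≡ 0 ⊎ ∃[ x ] (⟨ x , topRow S , ver ⟩ ∈ S)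
topRow≡0⊎attained [] = inj₁ refl
topRow≡0⊎attained (⟨ _ , _ , hor ⟩ ∷ S) with topRow≡0⊎attained S
... | inj₁ e       = inj₁ e
... | inj₂ (x , p) = inj₂ (x , there p)
topRow≡0⊎attained (⟨ x , y , ver ⟩ ∷ S) with topRow≡0⊎attained S | ≤-total (topRow S) y
... | _       | inj₁ le = inj₂ (x , subst (λ z → ⟨ x , z , ver ⟩ ∈ (⟨ x , y , ver ⟩ ∷ S))
                                        (sym (m≥n⇒m⊔n≡m le)) (here refl))
... | inj₁ e  | inj₂ _  = inj₂ (x , subst (λ z → ⟨ x , z , ver ⟩ ∈ (⟨ x , y , ver ⟩ ∷ S))
                                        (sym (m≥n⇒m⊔n≡m (subst (_≤ y) (sym e) z≤n))) (here refl))
... | inj₂ (x' , p) | inj₂ le = inj₂ (x' , subst (λ z → ⟨ x' , z , ver ⟩ ∈ (⟨ x , y , ver ⟩ ∷ S))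
                                        (sym (m≤n⇒m⊔n≡n le)) (there p))

TopRow-topRow : ∀ S x j → ⟨ x , j , ver ⟩ ∈ S → TopRow S (topRow S)
TopRow-topRow S x j p with topRow≡0⊎attained S
... | inj₂ q = q , ≤-topRow S
... | inj₁ e = (x , subst (λ z → ⟨ x , z , ver ⟩ ∈ S)
                     (trans (n≤0⇒n≡0 (subst (j ≤_) e (≤-topRow S x j p))) (sym e)) p)
             , ≤-topRow S

TopRow⇒≡topRow : ∀ S t → TopRow S t → topRow S ≡ t
TopRow⇒≡topRow S t ((x , p) , f) = ≤-antisym (topRow-least S t f) (≤-topRow S x t p)

TopRow-unique : ∀ S t t' → TopRow S t → TopRow S t' → t ≡ t'
TopRow-unique S t t' p q = trans (sym (TopRow⇒≡topRow S t p)) (TopRow⇒≡topRow S t' q)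

topRow-++ : ∀ S T → topRow (S ++ T) ≡ topRow S ⊔ topRow T
topRow-++ []                    T = refl
topRow-++ (⟨ _ , _ , hor ⟩ ∷ S) T = topRow-++ S T
topRow-++ (⟨ _ , y , ver ⟩ ∷ S) T =
  trans (cong (y ⊔_) (topRow-++ S T)) (sym (⊔-assoc y (topRow S) (topRow T)))

topRow-cap : ∀ x y i → topRow (cap x y i) ≡ 0
topRow-cap x y zero    = refl
topRow-cap x y (suc i) = topRow-cap (suc x) y i

isVerIn⇒≡ : ∀ t b → isVerIn t b ≡ true → b ≡ ⟨ bx b , t , ver ⟩
isVerIn⇒≡ t ⟨ x , y , ver ⟩ e = cong (λ z → ⟨ x , z , ver ⟩) (≡ᵇ⇒≡ y t (≡true⇒T e))

isVerIn-self : ∀ t x → isVerIn t ⟨ x , t , ver ⟩ ≡ true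
isVerIn-self t x = T⇒≡true (≡⇒≡ᵇ t t refl)

numVIn-∷ : ∀ t b S → numVIn t S ≤ numVIn t (b ∷ S)
numVIn-∷ t b S with isVerIn t b
... | true  = n≤1+n _
... | false = ≤-refl

numVIn≥1 : ∀ t x S → ⟨ x , t , ver ⟩ ∈ S → 1 ≤ numVIn t S
numVIn≥1 t x (b ∷ S) (here refl) rewrite isVerIn-self t x = s≤s z≤n
numVIn≥1 t x (b ∷ S) (there p)   = ≤-trans (numVIn≥1 t x S p) (numVIn-∷ t b S)

numVIn≥2 : ∀ t x x' S → x ≢ x' → ⟨ x , t , ver ⟩ ∈ S → ⟨ x' , t , ver ⟩ ∈ S → 2 ≤ numVIn t S
numVIn≥2 t x x' (b ∷ S) ne (here refl) (here refl) = ⊥-elim (ne refl)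
numVIn≥2 t x x' (b ∷ S) ne (here refl) (there q)   rewrite isVerIn-self t x  = s≤s (numVIn≥1 t x' S q)
numVIn≥2 t x x' (b ∷ S) ne (there p)   (here refl) rewrite isVerIn-self t x' = s≤s (numVIn≥1 t x S p)
numVIn≥2 t x x' (b ∷ S) ne (there p)   (there q)   = ≤-trans (numVIn≥2 t x x' S ne p q) (numVIn-∷ t b S)

numVIn≥3 : ∀ t x x' x'' S → x ≢ x' → x ≢ x'' → x' ≢ x'' →
  ⟨ x , t , ver ⟩ ∈ S → ⟨ x' , t , ver ⟩ ∈ S → ⟨ x'' , t , ver ⟩ ∈ S → 3 ≤ numVIn t S
numVIn≥3 t x x' x'' (b ∷ S) n₁ n₂ n₃ (here refl) (here refl) _ = ⊥-elim (n₁ refl)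
numVIn≥3 t x x' x'' (b ∷ S) n₁ n₂ n₃ (here refl) _ (here refl) = ⊥-elim (n₂ refl)
numVIn≥3 t x x' x'' (b ∷ S) n₁ n₂ n₃ (there _) (here refl) (here refl) = ⊥-elim (n₃ refl)
numVIn≥3 t x x' x'' (b ∷ S) n₁ n₂ n₃ (here refl) (there q) (there r)
  rewrite isVerIn-self t x = s≤s (numVIn≥2 t x' x'' S n₃ q r)
numVIn≥3 t x x' x'' (b ∷ S) n₁ n₂ n₃ (there p) (here refl) (there r)
  rewrite isVerIn-self t x' = s≤s (numVIn≥2 t x x'' S n₂ p r)
numVIn≥3 t x x' x'' (b ∷ S) n₁ n₂ n₃ (there p) (there q) (here refl)
  rewrite isVerIn-self t x'' = s≤s (numVIn≥2 t x x' S n₁ p q)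
numVIn≥3 t x x' x'' (b ∷ S) n₁ n₂ n₃ (there p) (there q) (there r) =
  ≤-trans (numVIn≥3 t x x' x'' S n₁ n₂ n₃ p q r) (numVIn-∷ t b S)

numVIn≥1⇒vertical : ∀ t S → 1 ≤ numVIn t S → ∃[ x ] (⟨ x , t , ver ⟩ ∈ S)
numVIn≥1⇒vertical t (b ∷ S) p with isVerIn t b in e
... | true  = bx b , subst (_∈ (b ∷ S)) (isVerIn⇒≡ t b e) (here refl)
... | false = let (x , q) = numVIn≥1⇒vertical t S p in x , there q

another-vertical : ∀ t x S → Unique S → ⟨ x , t , ver ⟩ ∈ S → 2 ≤ numVIn t S →
  ∃[ x' ] (x' ≢ x × ⟨ x' , t , ver ⟩ ∈ S)
another-vertical t x (b ∷ S) (b∉ ∷ _) (here refl) p rewrite isVerIn-self t x =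
  let (x' , q) = numVIn≥1⇒vertical t S (s≤s⁻¹ p) in
  x' , (λ { refl → All.lookup b∉ q refl }) , there q
another-vertical t x (b ∷ S) (b∉ ∷ u) (there m) p with isVerIn t b in e
... | true  = bx b , (λ { refl → All.lookup b∉ m (isVerIn⇒≡ t b e) })
                   , subst (_∈ (b ∷ S)) (isVerIn⇒≡ t b e) (here refl)
... | false = let (x' , ne , q) = another-vertical t x S u m p in x' , ne , there q

numVIn≡2 : ∀ S t x → TwoDirected S → ⟨ x , t , ver ⟩ ∈ S → numVIn t S ≡ 2
numVIn≡2 S t x (_ , two) x∈ with two t
... | inj₂ e = e
... | inj₁ e = ⊥-elim (1+n≰n (subst (1 ≤_) e (numVIn≥1 t x S x∈)))

record TopPair (S : BondSet) (t x₁ x₂ : ℕ) : Set where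
  constructor topPair
  field
    top   : TopRow S t
    x₁<x₂ : x₁ < x₂
    left  : ⟨ x₁ , t , ver ⟩ ∈ S
    right : ⟨ x₂ , t , ver ⟩ ∈ S
    only  : ∀ x → ⟨ x , t , ver ⟩ ∈ S → x ≡ x₁ ⊎ x ≡ x₂
open TopPair public

TwoDirected⇒TopPair : ∀ S t x₁ x₂ → TwoDirected S → TopRow S t → x₁ < x₂ →
  ⟨ x₁ , t , ver ⟩ ∈ S → ⟨ x₂ , t , ver ⟩ ∈ S → TopPair S t x₁ x₂
TwoDirected⇒TopPair S t x₁ x₂ td tr lt x₁∈ x₂∈ = topPair tr lt x₁∈ x₂∈ only′
  where
  only′ : ∀ x → ⟨ x , t , ver ⟩ ∈ S → x ≡ x₁ ⊎ x ≡ x₂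
  only′ x x∈ with x ≟ x₁ | x ≟ x₂
  ... | yes e | _     = inj₁ e
  ... | no _  | yes e = inj₂ e
  ... | no n₁ | no n₂ = ⊥-elim (<-irrefl refl (subst (3 ≤_) (numVIn≡2 S t x td x∈)
                          (numVIn≥3 t x x₁ x₂ S n₁ n₂ (<⇒≢ lt) x∈ x₁∈ x₂∈)))

topPair-exists : ∀ S → TwoDirected S → 1 ≤ numV S → ∃[ x₁ ] ∃[ x₂ ] TopPair S (topRow S) x₁ x₂
topPair-exists S td p with numV≥1⇒vertical S p
... | x , j , x∈ with TopRow-topRow S x j x∈
...   | tr with proj₁ tr
...     | xa , xa∈ with another-vertical (topRow S) xa S (canonical⇒unique (proj₁ (proj₁ td))) xa∈
                          (≤-reflexive (sym (numVIn≡2 S (topRow S) xa td xa∈)))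
...       | xb , xb≢xa , xb∈ with <-cmp xa xb
...         | tri< lt _ _ = xa , xb , TwoDirected⇒TopPair S _ xa xb td tr lt xa∈ xb∈
...         | tri≈ _ e _  = ⊥-elim (xb≢xa (sym e))
...         | tri> _ _ gt = xb , xa , TwoDirected⇒TopPair S _ xb xa td tr gt xb∈ xa∈

Width⇒TopPair : ∀ S w → TwoDirected S → Width S w →
  ∃[ t ] ∃[ x₁ ] ∃[ x₂ ] (TopPair S t x₁ x₂ × x₁ + w ≡ x₂)
Width⇒TopPair S w td (t , tr , x₁ , x₂ , x₁∈ , x₂∈ , lt , e) =
  t , x₁ , x₂ , TwoDirected⇒TopPair S t x₁ x₂ td tr lt x₁∈ x₂∈ , e

TopPair⇒Width : ∀ {S t x₁ x₂} → TopPair S t x₁ x₂ → Width S (x₂ ∸ x₁)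
TopPair⇒Width {t = t} {x₁} {x₂} p =
  t , top p , x₁ , x₂ , left p , right p , x₁<x₂ p , m+[n∸m]≡n (<⇒≤ (x₁<x₂ p))

TopPair-unique : ∀ {S t x₁ x₂ t' x₁' x₂'} → TopPair S t x₁ x₂ → TopPair S t' x₁' x₂' →
  t ≡ t' × x₁ ≡ x₁' × x₂ ≡ x₂'
TopPair-unique {S} {t} {x₁} {x₂} {t'} {x₁'} {x₂'} p p' with TopRow-unique S t t' (top p) (top p')
... | refl with only p x₁' (left p') | only p x₂' (right p')
... | inj₁ refl | inj₂ refl = refl , refl , refl
... | inj₁ refl | inj₁ refl = ⊥-elim (<-irrefl refl (x₁<x₂ p'))
... | inj₂ refl | inj₁ refl = ⊥-elim (<-asym (x₁<x₂ p) (x₁<x₂ p'))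
... | inj₂ refl | inj₂ refl = ⊥-elim (<-irrefl refl (x₁<x₂ p'))

Width-unique : ∀ S w w' → TwoDirected S → Width S w → Width S w' → w ≡ w'
Width-unique S w w' td p q with Width⇒TopPair S w td p | Width⇒TopPair S w' td q
... | t , x₁ , x₂ , tp , e | t' , x₁' , x₂' , tp' , e' with TopPair-unique tp tp'
... | refl , refl , refl = +-cancelˡ-≡ x₁ w w' (trans e (sym e'))

Reach-mono : ∀ {S S' v} → (∀ b → b ∈ S → b ∈ S') → Reach S v → Reach S' v
Reach-mono f origin      = origin
Reach-mono f (east r m)  = east (Reach-mono f r) (f _ m)
Reach-mono f (north r m) = north (Reach-mono f r) (f _ m)

Reach-restrict : ∀ {S U v} t → (∀ b → b ∈ S → by b ≤ t → b ∈ U) → Reach S v → proj₂ v ≤ t → Reach U v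
Reach-restrict t f origin      le = origin
Reach-restrict t f (east r m)  le = east (Reach-restrict t f r le) (f _ m le)
Reach-restrict t f (north r m) le =
  north (Reach-restrict t f r (≤-trans (n≤1+n _) le)) (f _ m (≤-trans (n≤1+n _) le))

Reach⇒vertical-below : ∀ {S v} → Reach S v → ∀ y → proj₂ v ≡ suc y → ∃[ x ] (⟨ x , y , ver ⟩ ∈ S)
Reach⇒vertical-below origin          y ()
Reach⇒vertical-below (east r m)      y e    = Reach⇒vertical-below r y e
Reach⇒vertical-below (north {x} r m) y refl = x , m

directed-height : ∀ S t → Directed S → TopRow S t → ∀ b → b ∈ S → by b ≤ suc t
directed-height S t d tr ⟨ x , y , ver ⟩     b∈ = ≤-trans (proj₂ tr x y b∈) (n≤1+n t)
directed-height S t d tr ⟨ x , zero , hor ⟩  b∈ = z≤n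
directed-height S t d tr ⟨ x , suc y , hor ⟩ b∈ with Reach⇒vertical-below (d _ b∈) y refl
... | x' , x'∈ = s≤s (proj₂ tr x' y x'∈)

module _ {S t x₁ x₂} (p : TopPair S t x₁ x₂) where

  Reach-above-top⇒≥left : ∀ {v} → Reach S v → proj₂ v ≡ suc t → x₁ ≤ proj₁ v
  Reach-above-top⇒≥left origin          ()
  Reach-above-top⇒≥left (east r m)      e    = ≤-trans (Reach-above-top⇒≥left r e) (n≤1+n _)
  Reach-above-top⇒≥left (north {x} r m) refl with only p x m
  ... | inj₁ refl = ≤-refl
  ... | inj₂ refl = <⇒≤ (x₁<x₂ p)

  Reach-above-top-last-step : ∀ {v} → Reach S v → proj₂ v ≡ suc t →
    proj₁ v ≡ x₁ ⊎ proj₁ v ≡ x₂ ⊎ ∃[ x ] (proj₁ v ≡ suc x × ⟨ x , suc t , hor ⟩ ∈ S)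
  Reach-above-top-last-step origin          ()
  Reach-above-top-last-step (east {x} r m)  refl = inj₂ (inj₂ (x , refl , m))
  Reach-above-top-last-step (north {x} r m) refl with only p x m
  ... | inj₁ e = inj₁ e
  ... | inj₂ e = inj₂ (inj₁ e)

LiesBetween-mono : ∀ {S S'} v → (∀ x j → ⟨ x , j , ver ⟩ ∈ S → ⟨ x , j , ver ⟩ ∈ S') →
  LiesBetween S v → LiesBetween S' v
LiesBetween-mono (x , y) f (j , e , x₁ , x₂ , x₁∈ , x₂∈ , l₁ , l₂) =
  j , e , x₁ , x₂ , f _ _ x₁∈ , f _ _ x₂∈ , l₁ , l₂

LiesBetween-above : ∀ {S t x₁ x₂} X → ⟨ x₁ , t , ver ⟩ ∈ S → ⟨ x₂ , t , ver ⟩ ∈ S →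
  x₁ ≤ X → X ≤ x₂ → LiesBetween S (X , suc t)
LiesBetween-above {t = t} {x₁} {x₂} X x₁∈ x₂∈ l₁ l₂ = t , inj₂ refl , x₁ , x₂ , x₁∈ , x₂∈ , l₁ , l₂

-- Removing and adding the cap

decap : BondSet → BondSet
decap S = filter (λ b → by b ≤? topRow S) S

capLength : BondSet → ℕ
capLength S = numH S ∸ numH (decap S)

module Capping (U : BondSet) (uP : UncappedPrimitive2D U) {t x₁ x₂ : ℕ} (pair : TopPair U t x₁ x₂)
               (i : ℕ) (x₁+i≤x₂ : x₁ + i ≤ x₂) where

  private
    canU = proj₁ (proj₁ (proj₁ (proj₁ uP)))
    dirU = proj₂ (proj₁ (proj₁ (proj₁ uP)))
    twoU = proj₂ (proj₁ (proj₁ uP))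
    degU = proj₂ (proj₁ uP)
    uncappedU = proj₂ uP

  C : BondSet
  C = cap x₁ (suc t) i

  S : BondSet
  S = U ++ C

  -- Followed westwards, a bond in row t + 1 ends in a bond capping x₁ or x₂.
  no-bond-above-top : ∀ x → ⟨ x , suc t , hor ⟩ ∈ U → ⊥
  no-bond-above-top x m with Reach-above-top-last-step pair (dirU _ m) refl
  ... | inj₁ refl                   = uncappedU t (top pair) x₁ (left pair)  _ m refl (inj₁ refl)
  ... | inj₂ (inj₁ refl)            = uncappedU t (top pair) x₂ (right pair) _ m refl (inj₁ refl)
  ... | inj₂ (inj₂ (x' , refl , m')) = no-bond-above-top x' m'

  U-below-top : ∀ b → b ∈ U → by b ≤ t
  U-below-top b m with m≤n⇒m<n∨m≡n (directed-height U t dirU (top pair) b m)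
  ... | inj₁ lt = s≤s⁻¹ lt
  U-below-top ⟨ x , y , ver ⟩ m | inj₂ _    = proj₂ (top pair) x y m
  U-below-top ⟨ x , y , hor ⟩ m | inj₂ refl = ⊥-elim (no-bond-above-top x m)

  topRow-S : topRow S ≡ t
  topRow-S = trans (topRow-++ U C)
    (trans (cong₂ _⊔_ (TopRow⇒≡topRow U t (top pair)) (topRow-cap x₁ (suc t) i)) (⊔-identityʳ t))

  decap-S : decap S ≡ U
  decap-S rewrite topRow-S = trans (filter-++ (λ b → by b ≤? t) U C)
    (trans (cong₂ _++_ (filter-all  (λ b → by b ≤? t) (All.tabulate (λ {b} → U-below-top b)))
                       (filter-none (λ b → by b ≤? t) (All.tabulate (λ {b} → C-above-top b))))
           (++-identityʳ U))
    where
    C-above-top : ∀ b → b ∈ C → ¬ (by b ≤ t)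
    C-above-top b m with ∈-cap⁻ x₁ (suc t) i b m
    ... | _ , _ , refl = 1+n≰n

  numH-S : numH S ≡ numH U + i
  numH-S = trans (numH-++ U C) (cong (numH U +_) (numH-cap x₁ (suc t) i))

  numV-S : numV S ≡ numV U
  numV-S = trans (numV-++ U C) (trans (cong (numV U +_) (numV-cap x₁ (suc t) i)) (+-identityʳ _))

  capLength-S : capLength S ≡ i
  capLength-S rewrite decap-S | numH-S = m+n∸m≡n (numH U) i

  private
    inU : ∀ {b} → b ∈ U → b ∈ S
    inU = ∈-++⁺ˡ

  canonical-S : Canonical S
  canonical-S = canonical-++ canU (cap-canonical x₁ (suc t) i) U<C
    where
    U<C : ∀ a b → a ∈ U → b ∈ C → a <ᴮ b
    U<C a b a∈ b∈ with ∈-cap⁻ x₁ (suc t) i b b∈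
    ... | _ , _ , refl = row< (s≤s (U-below-top a a∈))

  directed-S : Directed S
  directed-S b m with ∈-++⁻ U m
  ... | inj₁ mU = Reach-mono (λ _ → inU) (dirU b mU)
  ... | inj₂ mC with ∈-cap⁻ x₁ (suc t) i b mC
  ...   | d , d<i , refl = reach-cap d (<⇒≤ d<i)
    where
    reach-cap : ∀ d → d ≤ i → Reach S (x₁ + d , suc t)
    reach-cap zero _ rewrite +-identityʳ x₁ =
      north (Reach-mono (λ _ → inU) (dirU _ (left pair))) (inU (left pair))
    reach-cap (suc d) le rewrite +-suc x₁ d =
      east (reach-cap d (≤-trans (n≤1+n d) le)) (∈-++⁺ʳ U (∈-cap⁺ x₁ (suc t) i d le))

  two-S : ∀ j → numVIn j S ≡ 0 ⊎ numVIn j S ≡ 2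
  two-S j rewrite numVIn-++ j U C | numVIn-cap j x₁ (suc t) i | +-identityʳ (numVIn j U) = twoU j

  primitive-S : Primitive2D S
  primitive-S = ((canonical-S , directed-S) , two-S) , endpoints
    where
    endpoints : ∀ v → deg S v ≡ 1 → LiesBetween S v
    endpoints v e with deg-++-cap U x₁ (suc t) i v
    ... | inj₁ same = LiesBetween-mono v (λ _ _ → inU) (degU v (trans (sym same) e))
    ... | inj₂ (X , refl , l₁ , l₂) =
      LiesBetween-above X (inU (left pair)) (inU (right pair)) l₁ (≤-trans l₂ x₁+i≤x₂)

cap-uncapped : ∀ U → UncappedPrimitive2D U → ∀ w → Width U w → ∀ i → i ≤ w →
  ∃[ S ] (Primitive2D S × decap S ≡ U × capLength S ≡ i × numV S ≡ numV U × numH S ≡ numH U + i)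
cap-uncapped U uP w wU i i≤w with Width⇒TopPair U w (proj₁ (proj₁ uP)) wU
... | t , x₁ , x₂ , pair , x₁+w≡x₂ =
  S , primitive-S , decap-S , capLength-S , numV-S , numH-S
  where open Capping U uP pair i (≤-trans (+-monoʳ-≤ x₁ i≤w) (≤-reflexive x₁+w≡x₂))

rightmost : BondSet → ℕ
rightmost []      = 0
rightmost (b ∷ S) = bx b ⊔ rightmost S

bx≤rightmost : ∀ S b → b ∈ S → bx b ≤ rightmost S
bx≤rightmost (c ∷ S) b (here refl) = m≤m⊔n _ _
bx≤rightmost (c ∷ S) b (there m)   = ≤-trans (bx≤rightmost S b m) (m≤n⊔m _ _)

least-failure : (P : ℕ → Set) → (∀ n → Dec (P n)) → ∀ w → ¬ P w →
  ∃[ m ] (m ≤ w × ¬ P m × (∀ j → j < m → P j))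
least-failure P P? w ¬Pw = search 0 w refl (λ _ ())
  where
  search : ∀ m d → m + d ≡ w → (∀ j → j < m → P j) → ∃[ m ] (m ≤ w × ¬ P m × (∀ j → j < m → P j))
  search m d e below with P? m
  ... | no ¬Pm = m , subst (m ≤_) e (m≤m+n m d) , ¬Pm , below
  ... | yes Pm with d
  ...   | zero  = ⊥-elim (¬Pw (subst P (trans (sym (+-identityʳ m)) e) Pm))
  ...   | suc d′ = search (suc m) d′ (trans (sym (+-suc m d′)) e) below′
    where
    below′ : ∀ j → j < suc m → P j
    below′ j j<1+m with m≤n⇒m<n∨m≡n (s≤s⁻¹ j<1+m)
    ... | inj₁ j<m  = below j j<m
    ... | inj₂ refl = Pm

module Decapping (S : BondSet) (pS : Primitive2D S) {x₁ x₂ : ℕ} (pair : TopPair S (topRow S) x₁ x₂) where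

  private
    canS = proj₁ (proj₁ (proj₁ pS))
    dirS = proj₂ (proj₁ (proj₁ pS))
    twoS = proj₁ pS
    degS = proj₂ pS

  t : ℕ
  t = topRow S

  CapBond : ℕ → Set
  CapBond x = ⟨ x , suc t , hor ⟩ ∈ S

  CapBond⇒≥left : ∀ x → CapBond x → x₁ ≤ x
  CapBond⇒≥left x m = Reach-above-top⇒≥left pair (dirS _ m) refl

  private
    stop-is-endpoint : ∀ x → x₂ ≤ x → ¬ CapBond (suc x) →
      ∀ b → b ∈ S → Incident (suc x , suc t) b → b ≡ ⟨ x , suc t , hor ⟩
    stop-is-endpoint x le nm ⟨ _ , _ , hor ⟩ m (inj₁ refl) = ⊥-elim (nm m)
    stop-is-endpoint x le nm ⟨ _ , _ , hor ⟩ m (inj₂ refl) = refl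
    stop-is-endpoint x le nm ⟨ x' , _ , ver ⟩ m (inj₁ refl) = ⊥-elim (1+n≰n (proj₂ (top pair) x' (suc t) m))
    stop-is-endpoint x le nm ⟨ x' , _ , ver ⟩ m (inj₂ refl) with only pair (suc x) m
    ... | inj₁ e = ⊥-elim (1+n≰n (≤-trans (≤-reflexive e) (≤-trans (<⇒≤ (x₁<x₂ pair)) le)))
    ... | inj₂ e = ⊥-elim (1+n≰n (≤-trans (≤-reflexive e) le))

  -- If the cap stopped at some x + 1 > x₂, that vertex would have degree 1
  -- without lying between vertical bonds.
  CapBond-continues : ∀ x → x₂ ≤ x → CapBond x → CapBond (suc x)
  CapBond-continues x le m with ⟨ suc x , suc t , hor ⟩ ∈? S
  ... | yes m' = m'
  ... | no nm with degS (suc x , suc t) (deg≡1 S _ _ (canonical⇒unique canS) m (inj₂ refl) (stop-is-endpoint x le nm))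
  ...   | j , inj₁ refl , _ , x₂' , _ , x₂'∈ , _ , _ = ⊥-elim (1+n≰n (proj₂ (top pair) x₂' (suc t) x₂'∈))
  ...   | j , inj₂ refl , _ , x₂' , _ , x₂'∈ , _ , l₂ with only pair x₂' x₂'∈
  ...     | inj₁ e = ⊥-elim (1+n≰n (≤-trans l₂ (≤-trans (≤-reflexive e) (≤-trans (<⇒≤ (x₁<x₂ pair)) le))))
  ...     | inj₂ e = ⊥-elim (1+n≰n (≤-trans l₂ (≤-trans (≤-reflexive e) le)))

  CapBond⇒<right : ∀ x → CapBond x → x < x₂
  CapBond⇒<right x m with x₂ ≤? x
  ... | no x₂≰x = ≰⇒> x₂≰x
  ... | yes le  = ⊥-elim (runs-off (rightmost S) x (m≤n+m (rightmost S) x) le m)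
    where
    runs-off : ∀ d x → rightmost S ≤ x + d → x₂ ≤ x → CapBond x → ⊥
    runs-off zero x b le m =
      1+n≰n (≤-trans (bx≤rightmost S _ (CapBond-continues x le m)) (subst (rightmost S ≤_) (+-identityʳ x) b))
    runs-off (suc d) x b le m =
      runs-off d (suc x) (subst (rightmost S ≤_) (+-suc x d) b) (≤-trans le (n≤1+n x)) (CapBond-continues x le m)

  CapBond-pred : ∀ x → CapBond (suc x) → x₁ ≤ x → CapBond x
  CapBond-pred x m le with Reach-above-top-last-step pair (dirS _ m) refl
  ... | inj₁ e                       = ⊥-elim (1+n≰n (subst (_≤ x) (sym e) le))
  ... | inj₂ (inj₁ e)                = ⊥-elim (<-irrefl e (CapBond⇒<right (suc x) m))
  ... | inj₂ (inj₂ (x' , refl , m')) = m'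

  CapBond-down : ∀ y d → CapBond (y + d) → x₁ ≤ y → CapBond y
  CapBond-down y zero    m le = subst CapBond (+-identityʳ y) m
  CapBond-down y (suc d) m le =
    CapBond-down y d (CapBond-pred (y + d) (subst CapBond (+-suc y d) m) (≤-trans le (m≤m+n y d))) le

  w : ℕ
  w = x₂ ∸ x₁

  x₁+w≡x₂ : x₁ + w ≡ x₂
  x₁+w≡x₂ = m+[n∸m]≡n (<⇒≤ (x₁<x₂ pair))

  private
    first-gap : ∃[ m ] (m ≤ w × ¬ CapBond (x₁ + m) × (∀ j → j < m → CapBond (x₁ + j)))
    first-gap = least-failure (λ d → CapBond (x₁ + d)) (λ d → ⟨ x₁ + d , suc t , hor ⟩ ∈? S) w
                  (λ m → <-irrefl x₁+w≡x₂ (CapBond⇒<right _ m))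

  i : ℕ
  i = proj₁ first-gap

  i≤w : i ≤ w
  i≤w = proj₁ (proj₂ first-gap)

  CapBond⇒in-cap : ∀ x → CapBond x → ∃[ d ] (d < i × x ≡ x₁ + d)
  CapBond⇒in-cap x m with i ≤? (x ∸ x₁)
  ... | no i≰ = x ∸ x₁ , ≰⇒> i≰ , sym (m+[n∸m]≡n (CapBond⇒≥left x m))
  ... | yes i≤ = ⊥-elim (proj₁ (proj₂ (proj₂ first-gap)) (CapBond-down (x₁ + i) (x ∸ (x₁ + i))
         (subst CapBond (sym (m+[n∸m]≡n (≤-trans (+-monoʳ-≤ x₁ i≤) (≤-reflexive (m+[n∸m]≡n (CapBond⇒≥left x m)))))) m)
         (m≤m+n x₁ i)))

  U : BondSet
  U = decap S

  C : BondSet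
  C = cap x₁ (suc t) i

  private
    U⊆S : ∀ {b} → b ∈ U → b ∈ S
    U⊆S m = proj₁ (∈-filter⁻ (λ b → by b ≤? t) {xs = S} m)

    U-below-top : ∀ {b} → b ∈ U → by b ≤ t
    U-below-top m = proj₂ (∈-filter⁻ (λ b → by b ≤? t) {xs = S} m)

    below-top⇒∈U : ∀ b → b ∈ S → by b ≤ t → b ∈ U
    below-top⇒∈U b m le = ∈-filter⁺ (λ b → by b ≤? t) m le

    vertical∈U : ∀ x j → ⟨ x , j , ver ⟩ ∈ S → ⟨ x , j , ver ⟩ ∈ U
    vertical∈U x j m = below-top⇒∈U _ m (proj₂ (top pair) x j m)

  canonical-U : Canonical U
  canonical-U = Linkedₚ.filter⁺ (λ b → by b ≤? t) <ᴮ-trans canS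

  S≡U++C : S ≡ U ++ C
  S≡U++C = canonical-≡ canS canonical-U++C S⊆U++C U++C⊆S
    where
    canonical-U++C : Canonical (U ++ C)
    canonical-U++C = canonical-++ canonical-U (cap-canonical x₁ (suc t) i) U<C
      where
      U<C : ∀ a b → a ∈ U → b ∈ C → a <ᴮ b
      U<C a b a∈ b∈ with ∈-cap⁻ x₁ (suc t) i b b∈
      ... | _ , _ , refl = row< (s≤s (U-below-top a∈))
    S⊆U++C : ∀ z → z ∈ S → z ∈ U ++ C
    S⊆U++C z m with by z ≤? t
    ... | yes le = ∈-++⁺ˡ (below-top⇒∈U z m le)
    ... | no nle with m≤n⇒m<n∨m≡n (directed-height S t dirS (top pair) z m)
    ...   | inj₁ lt = ⊥-elim (nle (s≤s⁻¹ lt))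
    S⊆U++C ⟨ x , y , ver ⟩ m | no nle | inj₂ _ = ⊥-elim (nle (proj₂ (top pair) x y m))
    S⊆U++C ⟨ x , y , hor ⟩ m | no nle | inj₂ refl with CapBond⇒in-cap x m
    ... | d , d<i , refl = ∈-++⁺ʳ U (∈-cap⁺ x₁ (suc t) i d d<i)
    U++C⊆S : ∀ z → z ∈ U ++ C → z ∈ S
    U++C⊆S z m with ∈-++⁻ U m
    ... | inj₁ mU = U⊆S mU
    ... | inj₂ mC with ∈-cap⁻ x₁ (suc t) i z mC
    ...   | d , d<i , refl = proj₂ (proj₂ (proj₂ first-gap)) d d<i

  pair-U : TopPair U t x₁ x₂
  pair-U = topPair ((x₁ , vertical∈U _ _ (left pair)) , (λ x j m → proj₂ (top pair) x j (U⊆S m)))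
                   (x₁<x₂ pair) (vertical∈U _ _ (left pair)) (vertical∈U _ _ (right pair))
                   (λ x m → only pair x (U⊆S m))

  uncappedPrimitive-U : UncappedPrimitive2D U
  uncappedPrimitive-U = ((((canonical-U , directed-U) , two-U) , endpoints) , uncapped)
    where
    directed-U : Directed U
    directed-U b m = Reach-restrict t below-top⇒∈U (dirS b (U⊆S m)) (U-below-top m)
    two-U : ∀ j → numVIn j U ≡ 0 ⊎ numVIn j U ≡ 2
    two-U j = subst (λ n → n ≡ 0 ⊎ n ≡ 2)
      (trans (cong (numVIn j) S≡U++C) (trans (numVIn-++ j U C)
        (trans (cong (numVIn j U +_) (numVIn-cap j x₁ (suc t) i)) (+-identityʳ _))))
      (proj₂ twoS j)
    endpoints : ∀ v → deg U v ≡ 1 → LiesBetween U v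
    endpoints v e with deg-++-cap U x₁ (suc t) i v
    ... | inj₁ same = LiesBetween-mono v vertical∈U
                        (degS v (trans (cong (λ T → deg T v) S≡U++C) (trans same e)))
    ... | inj₂ (X , refl , l₁ , l₂) = LiesBetween-above X (left pair-U) (right pair-U) l₁
                                        (≤-trans l₂ (≤-trans (+-monoʳ-≤ x₁ i≤w) (≤-reflexive x₁+w≡x₂)))
    uncapped : Uncapped U
    uncapped t' tr x m ⟨ _ , _ , hor ⟩ mb refl v~b with TopRow-unique U t' t tr (top pair-U)
    ... | refl with v~b
    ...   | inj₁ e = 1+n≰n (subst (_≤ t) (cong proj₂ e) (U-below-top mb))
    ...   | inj₂ e = 1+n≰n (subst (_≤ t) (cong proj₂ e) (U-below-top mb))

  numH-S : numH S ≡ numH U + i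
  numH-S = trans (cong numH S≡U++C) (trans (numH-++ U C) (cong (numH U +_) (numH-cap x₁ (suc t) i)))

  numV-S : numV S ≡ numV U
  numV-S = trans (cong numV S≡U++C)
    (trans (numV-++ U C) (trans (cong (numV U +_) (numV-cap x₁ (suc t) i)) (+-identityʳ _)))

  capLength-S : capLength S ≡ i
  capLength-S = trans (cong (_∸ numH U) numH-S) (m+n∸m≡n (numH U) i)

decap-uncapped : ∀ S → Primitive2D S → 1 ≤ numV S →
  UncappedPrimitive2D (decap S) × numV (decap S) ≡ numV S × numH (decap S) + capLength S ≡ numH S ×
  ∃[ w ] (Width (decap S) w × capLength S ≤ w)
decap-uncapped S pS nv with topPair-exists S (proj₁ pS) nv
... | _ , _ , pair =
  uncappedPrimitive-U , sym numV-S , sym (trans numH-S (cong (numH U +_) (sym capLength-S))) ,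
  w , TopPair⇒Width pair-U , subst (_≤ w) (sym capLength-S) i≤w
  where open Decapping S pS pair

decap-injective : ∀ S S' → Primitive2D S → Primitive2D S' → 1 ≤ numV S → 1 ≤ numV S' →
  capLength S ≡ capLength S' → decap S ≡ decap S' → S ≡ S'
decap-injective S S' pS pS' nv nv' same-cap same-decap
  with topPair-exists S (proj₁ pS) nv | topPair-exists S' (proj₁ pS') nv'
... | x₁ , x₂ , pair | x₁' , x₂' , pair' =
  trans D.S≡U++C (trans (cong₂ _++_ same-decap (cap-cong t≡t' x₁≡x₁' i≡i')) (sym D'.S≡U++C))
  where
  module D  = Decapping S  pS  pair
  module D' = Decapping S' pS' pair'
  same-pair = TopPair-unique D.pair-U (subst (λ V → TopPair V D'.t x₁' x₂') (sym same-decap) D'.pair-U)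
  t≡t'   = proj₁ same-pair
  x₁≡x₁' = proj₁ (proj₂ same-pair)
  i≡i' : D.i ≡ D'.i
  i≡i' = trans (sym D.capLength-S) (trans same-cap D'.capLength-S)
  cap-cong : ∀ {x x' s s' j j'} → s ≡ s' → x ≡ x' → j ≡ j' → cap x (suc s) j ≡ cap x' (suc s') j'
  cap-cong refl refl refl = refl

-- Counting

Σℕ : ℕ → (ℕ → ℕ) → ℕ
Σℕ zero    g = g 0
Σℕ (suc k) g = Σℕ k g + g (suc k)

Σℕ-cong : ∀ k g h → (∀ i → g i ≡ h i) → Σℕ k g ≡ Σℕ k h
Σℕ-cong zero    g h e = e 0
Σℕ-cong (suc k) g h e = cong₂ _+_ (Σℕ-cong k g h e) (e (suc k))

Σℕ-+ : ∀ k g h → Σℕ k (λ i → g i + h i) ≡ Σℕ k g + Σℕ k h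
Σℕ-+ zero    g h = refl
Σℕ-+ (suc k) g h rewrite Σℕ-+ k g h = interchange (Σℕ k g) (Σℕ k h) (g (suc k)) (h (suc k))
  where
  interchange : ∀ p q r s → (p + q) + (r + s) ≡ (p + r) + (q + s)
  interchange = ℕ-solve

Σℕ-0 : ∀ k → Σℕ k (λ _ → 0) ≡ 0
Σℕ-0 zero    = refl
Σℕ-0 (suc k) = cong (_+ 0) (Σℕ-0 k)

δ : ℕ → ℕ → ℕ
δ m i = if m ≡ᵇ i then 1 else 0

δ-≢ : ∀ m i → m ≢ i → δ m i ≡ 0
δ-≢ m i m≢i with m ≡ᵇ i in e
... | true  = ⊥-elim (m≢i (≡ᵇ⇒≡ m i (≡true⇒T e)))
... | false = refl

δ-refl : ∀ m → δ m m ≡ 1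
δ-refl m rewrite T⇒≡true (≡⇒≡ᵇ m m refl) = refl

Σℕ-δ-< : ∀ k m → k < m → Σℕ k (δ m) ≡ 0
Σℕ-δ-< zero    m lt = δ-≢ m 0 (λ { refl → <-irrefl refl lt })
Σℕ-δ-< (suc k) m lt =
  cong₂ _+_ (Σℕ-δ-< k m (≤-trans (n≤1+n _) lt)) (δ-≢ m (suc k) (λ { refl → <-irrefl refl lt }))

Σℕ-δ-≤ : ∀ k m → m ≤ k → Σℕ k (δ m) ≡ 1
Σℕ-δ-≤ zero    zero _ = refl
Σℕ-δ-≤ (suc k) m  le with m≤n⇒m<n∨m≡n le
... | inj₁ lt   = cong₂ _+_ (Σℕ-δ-≤ k m (s≤s⁻¹ lt)) (δ-≢ m (suc k) (<⇒≢ lt))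
... | inj₂ refl = cong₂ _+_ (Σℕ-δ-< k (suc k) ≤-refl) (δ-refl (suc k))

length-filter-≟-∷ : {A : Set} (f : A → ℕ) (x : A) (L : List A) (i : ℕ) →
  length (filter (λ y → f y ≟ i) (x ∷ L)) ≡ δ (f x) i + length (filter (λ y → f y ≟ i) L)
length-filter-≟-∷ f x L i with f x ≡ᵇ i
... | true  = refl
... | false = refl

length-partition : {A : Set} (f : A → ℕ) (k : ℕ) (L : List A) → All (λ x → f x ≤ k) L →
  length L ≡ Σℕ k (λ i → length (filter (λ y → f y ≟ i) L))
length-partition f k []      _        = sym (Σℕ-0 k)
length-partition f k (x ∷ L) (p ∷ ps) = sym (begin
    Σℕ k (λ i → length (filter (λ y → f y ≟ i) (x ∷ L)))
  ≡⟨ Σℕ-cong k _ _ (length-filter-≟-∷ f x L) ⟩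
    Σℕ k (λ i → δ (f x) i + length (filter (λ y → f y ≟ i) L))
  ≡⟨ Σℕ-+ k _ _ ⟩
    Σℕ k (δ (f x)) + Σℕ k (λ i → length (filter (λ y → f y ≟ i) L))
  ≡⟨ cong₂ _+_ (Σℕ-δ-≤ k (f x) p) (sym (length-partition f k L ps)) ⟩
    suc (length L) ∎)
  where open ≡-Reasoning

-- number of uncapped animals with h horizontal bonds and width below i
narrowCount : (ℕ → ℕ → ℕ) → ℕ → ℕ → ℕ
narrowCount c h zero    = 0
narrowCount c h (suc i) = narrowCount c h i + c h i

module Counting (n : ℕ) (n≥1 : 1 ≤ n) (a b : ℕ → ℕ) (c : ℕ → ℕ → ℕ)
  (ha : ∀ k → IsCount (λ S → Primitive2D S × numV S ≡ 2 * n × numH S ≡ k) (a k))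
  (hb : ∀ h → IsCount (λ S → UncappedPrimitive2D S × numV S ≡ 2 * n × numH S ≡ h) (b h))
  (hc : ∀ h w → IsCount (λ S → UncappedPrimitive2D S × numV S ≡ 2 * n × numH S ≡ h × Width S w) (c h w))
  where

  Counted : ℕ → BondSet → Set
  Counted h U = UncappedPrimitive2D U × numV U ≡ 2 * n × numH U ≡ h

  numV≥1 : ∀ S → numV S ≡ 2 * n → 1 ≤ numV S
  numV≥1 S e = subst (1 ≤_) (sym e) (≤-trans n≥1 (m≤m+n n _))

  primitives : ℕ → List BondSet
  primitives k = proj₁ (ha k)

  ∈-primitives⁻ : ∀ k S → S ∈ primitives k → Primitive2D S × numV S ≡ 2 * n × numH S ≡ k
  ∈-primitives⁻ k S m = All.lookup (proj₁ (proj₂ (proj₂ (ha k)))) m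

  withCap : ℕ → ℕ → List BondSet
  withCap k i = filter (λ S → capLength S ≟ i) (primitives k)

  decapped : ℕ → ℕ → List BondSet
  decapped k i = map decap (withCap k i)

  ∈-decapped⁻ : ∀ k i U → U ∈ decapped k i → Counted (k ∸ i) U × ∃[ w ] (i ≤ w × Width U w)
  ∈-decapped⁻ k i U m with ∈-map⁻ decap m
  ... | S , mS , refl =
    let (mP , cl)        = ∈-filter⁻ (λ S → capLength S ≟ i) {xs = primitives k} mS
        (pS , nvS , nhS) = ∈-primitives⁻ k S mP
        (uP , nvU , nhU , w , wU , cap≤w) = decap-uncapped S pS (numV≥1 S nvS)
    in (uP , trans nvU nvS , trans (sym (m+n∸n≡m _ (capLength S))) (cong₂ _∸_ (trans nhU nhS) cl)) ,
       w , subst (_≤ w) cl cap≤w , wU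

  ∈-decapped⁺ : ∀ k i U → i ≤ k → Counted (k ∸ i) U → ∀ w → i ≤ w → Width U w → U ∈ decapped k i
  ∈-decapped⁺ k i U i≤k (uP , nvU , nhU) w i≤w wU with cap-uncapped U uP w wU i i≤w
  ... | S , pS , decap-S , capLength-S , numV-S , numH-S =
    subst (_∈ decapped k i) decap-S (∈-map⁺ decap
      (∈-filter⁺ (λ S → capLength S ≟ i) (proj₁ (proj₂ (proj₂ (proj₂ (ha k)))) S counted) capLength-S))
    where
    counted : Primitive2D S × numV S ≡ 2 * n × numH S ≡ k
    counted = pS , trans numV-S nvU , trans numH-S (trans (cong (_+ i) nhU) (m∸n+n≡m i≤k))

  decapped-unique : ∀ k i → Unique (decapped k i)
  decapped-unique k i = map⁺-injectiveOn decap inj (Uniqueₚ.filter⁺ (λ S → capLength S ≟ i) (proj₁ (proj₂ (ha k))))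
    where
    inj : ∀ S S' → S ∈ withCap k i → S' ∈ withCap k i → decap S ≡ decap S' → S ≡ S'
    inj S S' m m' e
      with ∈-filter⁻ (λ S → capLength S ≟ i) {xs = primitives k} m
         | ∈-filter⁻ (λ S → capLength S ≟ i) {xs = primitives k} m'
    ... | mP , cl | mP' , cl' with ∈-primitives⁻ k S mP | ∈-primitives⁻ k S' mP'
    ... | pS , nvS , _ | pS' , nvS' , _ =
      decap-injective S S' pS pS' (numV≥1 S nvS) (numV≥1 S' nvS') (trans cl (sym cl')) e

  narrow : ℕ → ℕ → List BondSet
  narrow h zero    = []
  narrow h (suc i) = narrow h i ++ proj₁ (hc h i)

  ∈-narrow⁻ : ∀ h i U → U ∈ narrow h i → ∃[ w ] (w < i × Counted h U × Width U w)
  ∈-narrow⁻ h (suc i) U m with ∈-++⁻ (narrow h i) m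
  ... | inj₁ m₁ = let (w , w<i , p) = ∈-narrow⁻ h i U m₁ in w , ≤-trans w<i (n≤1+n i) , p
  ... | inj₂ m₂ = let (uP , nv , nh , wU) = All.lookup (proj₁ (proj₂ (proj₂ (hc h i)))) m₂ in
                  i , ≤-refl , (uP , nv , nh) , wU

  ∈-narrow⁺ : ∀ h i U w → w < i → Counted h U → Width U w → U ∈ narrow h i
  ∈-narrow⁺ h (suc i) U w w<1+i (uP , nv , nh) wU with m≤n⇒m<n∨m≡n (s≤s⁻¹ w<1+i)
  ... | inj₁ w<i  = ∈-++⁺ˡ (∈-narrow⁺ h i U w w<i (uP , nv , nh) wU)
  ... | inj₂ refl = ∈-++⁺ʳ (narrow h i) (proj₁ (proj₂ (proj₂ (proj₂ (hc h w)))) U (uP , nv , nh , wU))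

  narrow-unique : ∀ h i → Unique (narrow h i)
  narrow-unique h zero    = []
  narrow-unique h (suc i) = Uniqueₚ.++⁺ (narrow-unique h i) (proj₁ (proj₂ (hc h i))) disjoint
    where
    disjoint : ∀ {U} → ¬ (U ∈ narrow h i × U ∈ proj₁ (hc h i))
    disjoint {U} (m₁ , m₂) with ∈-narrow⁻ h i U m₁ | All.lookup (proj₁ (proj₂ (proj₂ (hc h i)))) m₂
    ... | w , w<i , (uP , _ , _) , wU | _ , _ , _ , wU' =
      <-irrefl (Width-unique U w i (proj₁ (proj₁ uP)) wU wU') w<i

  length-narrow : ∀ h i → length (narrow h i) ≡ narrowCount c h i
  length-narrow h zero    = refl
  length-narrow h (suc i) =
    trans (length-++ (narrow h i)) (cong₂ _+_ (length-narrow h i) (proj₂ (proj₂ (proj₂ (proj₂ (hc h i))))))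

  -- An uncapped animal of width w ≥ i is the decap of exactly one primitive
  -- animal with cap length i; those of width w < i are counted by c.
  b-split : ∀ k i → i ≤ k → b (k ∸ i) ≡ narrowCount c (k ∸ i) i + length (withCap k i)
  b-split k i i≤k = begin
      b h
    ≡⟨ sym (IsCount⇒length≡ (hb h) (narrow h i ++ decapped k i) unique sound complete) ⟩
      length (narrow h i ++ decapped k i)
    ≡⟨ length-++ (narrow h i) ⟩
      length (narrow h i) + length (decapped k i)
    ≡⟨ cong₂ _+_ (length-narrow h i) (length-map decap (withCap k i)) ⟩
      narrowCount c h i + length (withCap k i) ∎
    where
    open ≡-Reasoning
    h = k ∸ i
    unique : Unique (narrow h i ++ decapped k i)
    unique = Uniqueₚ.++⁺ (narrow-unique h i) (decapped-unique k i) disjoint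
      where
      disjoint : ∀ {U} → ¬ (U ∈ narrow h i × U ∈ decapped k i)
      disjoint {U} (m₁ , m₂) with ∈-narrow⁻ h i U m₁ | ∈-decapped⁻ k i U m₂
      ... | w , w<i , (uP , _) , wU | _ , (w' , i≤w' , wU') =
        <-irrefl refl (≤-trans w<i (≤-trans i≤w' (≤-reflexive (Width-unique U w' w (proj₁ (proj₁ uP)) wU' wU))))
    sound : ∀ U → U ∈ narrow h i ++ decapped k i → Counted h U
    sound U m with ∈-++⁻ (narrow h i) m
    ... | inj₁ m₁ = proj₁ (proj₂ (proj₂ (∈-narrow⁻ h i U m₁)))
    ... | inj₂ m₂ = proj₁ (∈-decapped⁻ k i U m₂)
    complete : ∀ U → Counted h U → U ∈ narrow h i ++ decapped k i
    complete U cU@(uP , nvU , _) with topPair-exists U (proj₁ (proj₁ uP)) (numV≥1 U nvU)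
    ... | x₁ , x₂ , pair with (x₂ ∸ x₁) <? i
    ...   | yes w<i = ∈-++⁺ˡ (∈-narrow⁺ h i U (x₂ ∸ x₁) w<i cU (TopPair⇒Width pair))
    ...   | no  w≮i = ∈-++⁺ʳ (narrow h i) (∈-decapped⁺ k i U i≤k cU (x₂ ∸ x₁) (≮⇒≥ w≮i) (TopPair⇒Width pair))

  a-split : ∀ k → a k ≡ Σℕ k (λ i → length (withCap k i))
  a-split k = trans (sym (proj₂ (proj₂ (proj₂ (proj₂ (ha k))))))
    (length-partition capLength k (primitives k)
      (All.tabulate (λ {S} m → ≤-trans (m∸n≤m (numH S) (numH (decap S)))
                                       (≤-reflexive (proj₂ (proj₂ (∈-primitives⁻ k S m)))))))

-- Coefficient arithmetic

open ℤ using (+_)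

sumTo-cong : ∀ k (f g : PS) → (∀ i → i ≤ k → f i ≡ g i) → sumTo k f ≡ sumTo k g
sumTo-cong zero    f g e = e 0 z≤n
sumTo-cong (suc k) f g e =
  cong₂ ℤ._+_ (sumTo-cong k f g (λ i le → e i (≤-trans le (n≤1+n k)))) (e (suc k) ≤-refl)

sumTo-+ : ∀ k (f g : PS) → sumTo k (λ i → f i ℤ.+ g i) ≡ sumTo k f ℤ.+ sumTo k g
sumTo-+ zero    f g = refl
sumTo-+ (suc k) f g rewrite sumTo-+ k f g = interchange (sumTo k f) (sumTo k g) (f (suc k)) (g (suc k))
  where
  interchange : ∀ p q r s → (p ℤ.+ q) ℤ.+ (r ℤ.+ s) ≡ (p ℤ.+ r) ℤ.+ (q ℤ.+ s)
  interchange = ℤ-solve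

sumTo-- : ∀ k (f g : PS) → sumTo k (λ i → f i ℤ.- g i) ≡ sumTo k f ℤ.- sumTo k g
sumTo-- zero    f g = refl
sumTo-- (suc k) f g rewrite sumTo-- k f g = interchange (sumTo k f) (sumTo k g) (f (suc k)) (g (suc k))
  where
  interchange : ∀ p q r s → (p ℤ.- q) ℤ.+ (r ℤ.- s) ≡ (p ℤ.+ r) ℤ.- (q ℤ.+ s)
  interchange = ℤ-solve

sumTo-suc : ∀ k (f : PS) → sumTo (suc k) f ≡ f 0 ℤ.+ sumTo k (λ i → f (suc i))
sumTo-suc zero    f = refl
sumTo-suc (suc k) f rewrite sumTo-suc k f = ℤₚ.+-assoc (f 0) _ _

sumTo-reverse : ∀ k (f : PS) → sumTo k (λ i → f (k ∸ i)) ≡ sumTo k f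
sumTo-reverse zero    f = refl
sumTo-reverse (suc k) f = begin
    sumTo k (λ i → f (suc k ∸ i)) ℤ.+ f (k ∸ k)
  ≡⟨ cong₂ (λ s j → s ℤ.+ f j) (sumTo-cong k _ _ (λ i le → cong f (+-∸-assoc 1 le))) (n∸n≡0 k) ⟩
    sumTo k (λ i → f (suc (k ∸ i))) ℤ.+ f 0
  ≡⟨ cong (ℤ._+ f 0) (sumTo-reverse k (λ j → f (suc j))) ⟩
    sumTo k (λ j → f (suc j)) ℤ.+ f 0
  ≡⟨ ℤₚ.+-comm _ (f 0) ⟩
    f 0 ℤ.+ sumTo k (λ j → f (suc j))
  ≡⟨ sym (sumTo-suc k f) ⟩
    sumTo (suc k) f ∎
  where open ≡-Reasoning

+-Σℕ : ∀ k g → + Σℕ k g ≡ sumTo k (λ i → + g i)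
+-Σℕ zero    g = refl
+-Σℕ (suc k) g = trans (ℤₚ.pos-+ (Σℕ k g) (g (suc k))) (cong (ℤ._+ + g (suc k)) (+-Σℕ k g))

X⊛-suc : ∀ (f : PS) k → (X ⊛ f) (suc k) ≡ f k
X⊛-suc f zero    = trans (ℤₚ.+-identityˡ _) (ℤₚ.*-identityˡ (f 0))
X⊛-suc f (suc k) = begin
    (X ⊛ f) (suc (suc k))
  ≡⟨ trans (sumTo-suc (suc k) _) (ℤₚ.+-identityˡ _) ⟩
    sumTo (suc k) (λ i → X (suc i) ℤ.* f (suc k ∸ i))
  ≡⟨ sumTo-suc k _ ⟩
    1ℤ ℤ.* f (suc k) ℤ.+ sumTo k (λ i → 0ℤ)
  ≡⟨ cong₂ ℤ._+_ (ℤₚ.*-identityˡ (f (suc k))) (sumTo-zero k) ⟩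
    f (suc k) ℤ.+ 0ℤ
  ≡⟨ ℤₚ.+-identityʳ _ ⟩
    f (suc k) ∎
  where
  open ≡-Reasoning
  sumTo-zero : ∀ k → sumTo k (λ _ → 0ℤ) ≡ 0ℤ
  sumTo-zero zero    = refl
  sumTo-zero (suc k) = cong (ℤ._+ 0ℤ) (sumTo-zero k)

geom⊛ : ∀ (f : PS) k → (geom ⊛ f) k ≡ sumTo k (λ i → f (k ∸ i))
geom⊛ f k = sumTo-cong k _ _ (λ i _ → ℤₚ.*-identityˡ (f (k ∸ i)))

module _ (c : ℕ → ℕ → ℕ) where

  diagonal : PS
  diagonal j = sumTo j (λ h → + c h (j ∸ h))

  -- Both sides are Σ c h w over h + w < k, grouped by h, resp. by h + w.
  narrowCount-diagonal : ∀ k → sumTo k (λ h → + narrowCount c h (k ∸ h)) ≡ sumTo k (X ⊛ diagonal)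
  narrowCount-diagonal zero    = refl
  narrowCount-diagonal (suc k) = begin
      sumTo k (λ h → + narrowCount c h (suc k ∸ h)) ℤ.+ + narrowCount c (suc k) (k ∸ k)
    ≡⟨ cong (λ j → sumTo k (λ h → + narrowCount c h (suc k ∸ h)) ℤ.+ + narrowCount c (suc k) j) (n∸n≡0 k) ⟩
      sumTo k (λ h → + narrowCount c h (suc k ∸ h)) ℤ.+ 0ℤ
    ≡⟨ ℤₚ.+-identityʳ _ ⟩
      sumTo k (λ h → + narrowCount c h (suc k ∸ h))
    ≡⟨ sumTo-cong k _ _ (λ h le → trans (cong (λ j → + narrowCount c h j) (+-∸-assoc 1 le))
                                         (ℤₚ.pos-+ (narrowCount c h (k ∸ h)) (c h (k ∸ h)))) ⟩
      sumTo k (λ h → + narrowCount c h (k ∸ h) ℤ.+ + c h (k ∸ h))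
    ≡⟨ sumTo-+ k _ _ ⟩
      sumTo k (λ h → + narrowCount c h (k ∸ h)) ℤ.+ diagonal k
    ≡⟨ cong₂ ℤ._+_ (narrowCount-diagonal k) (sym (X⊛-suc diagonal k)) ⟩
      sumTo (suc k) (X ⊛ diagonal) ∎
    where open ≡-Reasoning

  narrowCount-diagonal-reversed : ∀ k →
    sumTo k (λ i → + narrowCount c (k ∸ i) i) ≡ sumTo k (λ i → (X ⊛ diagonal) (k ∸ i))
  narrowCount-diagonal-reversed k = begin
      sumTo k (λ i → + narrowCount c (k ∸ i) i)
    ≡⟨ sumTo-cong k _ _ (λ i le → cong (λ j → + narrowCount c (k ∸ i) j) (sym (m∸[m∸n]≡n le))) ⟩
      sumTo k (λ i → + narrowCount c (k ∸ i) (k ∸ (k ∸ i)))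
    ≡⟨ sumTo-reverse k (λ h → + narrowCount c h (k ∸ h)) ⟩
      sumTo k (λ h → + narrowCount c h (k ∸ h))
    ≡⟨ narrowCount-diagonal k ⟩
      sumTo k (X ⊛ diagonal)
    ≡⟨ sym (sumTo-reverse k (X ⊛ diagonal)) ⟩
      sumTo k (λ i → (X ⊛ diagonal) (k ∸ i)) ∎
    where open ≡-Reasoning

  coefficient-identity : ∀ k (a b F : ℕ → ℕ) → a k ≡ Σℕ k F →
    (∀ i → i ≤ k → b (k ∸ i) ≡ narrowCount c (k ∸ i) i + F i) →
    + a k ≡ (geom ⊛ ((λ h → + b h) ⊖ (X ⊛ diagonal))) k
  coefficient-identity k a b F a≡ΣF b-split = sym (begin
      (geom ⊛ ((λ h → + b h) ⊖ (X ⊛ diagonal))) k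
    ≡⟨ geom⊛ ((λ h → + b h) ⊖ (X ⊛ diagonal)) k ⟩
      sumTo k (λ i → + b (k ∸ i) ℤ.- D i)
    ≡⟨ sumTo-- k _ _ ⟩
      sumTo k (λ i → + b (k ∸ i)) ℤ.- sumTo k D
    ≡⟨ cong (ℤ._- sumTo k D) (sumTo-cong k _ _ (λ i le →
         trans (cong +_ (b-split i le)) (ℤₚ.pos-+ (narrowCount c (k ∸ i) i) (F i)))) ⟩
      sumTo k (λ i → + narrowCount c (k ∸ i) i ℤ.+ + F i) ℤ.- sumTo k D
    ≡⟨ cong (ℤ._- sumTo k D) (sumTo-+ k _ _) ⟩
      (sumTo k (λ i → + narrowCount c (k ∸ i) i) ℤ.+ sumTo k (λ i → + F i)) ℤ.- sumTo k D
    ≡⟨ cong (λ s → (s ℤ.+ sumTo k (λ i → + F i)) ℤ.- sumTo k D) (narrowCount-diagonal-reversed k) ⟩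
      (sumTo k D ℤ.+ sumTo k (λ i → + F i)) ℤ.- sumTo k D
    ≡⟨ cancel (sumTo k D) (sumTo k (λ i → + F i)) ⟩
      sumTo k (λ i → + F i)
    ≡⟨ sym (+-Σℕ k F) ⟩
      + Σℕ k F
    ≡⟨ cong +_ (sym a≡ΣF) ⟩
      + a k ∎)
    where
    open ≡-Reasoning
    D : PS
    D i = (X ⊛ diagonal) (k ∸ i)
    cancel : ∀ p q → (p ℤ.+ q) ℤ.- p ≡ q
    cancel = ℤ-solve

mainTheorem8 : (n : ℕ) → 1 ≤ n → (a b : ℕ → ℕ) → (c : ℕ → ℕ → ℕ) →
    (∀ k → IsCount (λ S → Primitive2D S × numV S ≡ 2 * n × numH S ≡ k) (a k)) →
    (∀ h → IsCount (λ S → UncappedPrimitive2D S × numV S ≡ 2 * n × numH S ≡ h) (b h)) →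
    (∀ h w → IsCount (λ S → UncappedPrimitive2D S × numV S ≡ 2 * n × numH S ≡ h × Width S w) (c h w)) →
    ∀ k → + (a k) ≡ (geom ⊛ ((λ h → + (b h)) ⊖ (X ⊛ (λ j → sumTo j (λ h → + (c h (j ∸ h))))))) k
mainTheorem8 n n≥1 a b c ha hb hc k =
  coefficient-identity c k a b (λ i → length (withCap k i)) (a-split k) (b-split k)
  where open Counting n n≥1 a b c ha hb hc
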